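{- There exist co-finitary matroids $M_1$ and $M_2$ such that $\mathcal{I}(M_1\vee M_2)$ is not the set of independent sets of a matroid.
   Context: Matroids may be infinite: a matroid on $E$ is a pair $(E,\mathcal{I})$ with $\mathcal{I}\subseteq\mathcal{P}(E)$ satisfying (I1) $\emptyset\in\mathcal{I}$; (I2) closure under subsets; (I3) whenever $I,I'\in\mathcal{I}$ with $I'$ maximal and $I$ not maximal, there is $x\in I'\setminus I$ with $I+x\in\mathcal{I}$; (IM) whenever $I\subseteq X\subseteq E$ and $I\in\mathcal{I}$, the set $\{I'\in\mathcal{I}: I\subseteq I'\subseteq X\}$ has a maximal element. The dual $M^*$ has as bases the complements of the bases (maximal independent sets) of $M$. $M$ is finitary if every set all of whose finite subsets are independent is independent; co-finitary if $M^*$ is finitary. $\mathcal{I}(M_1\vee M_2)=\{I_1\cup I_2: I_1\in\mathcal{I}(M_1), I_2\in\mathcal{I}(M_2)\}$. -}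

module Defs where

open import Data.Product using (Σ; Σ-syntax; ∃; ∃-syntax; _×_; _,_)
open import Data.Sum using (_⊎_)
open import Data.List using (List)
open import Data.Empty using (⊥)
open import Data.List.Membership.Propositional using (_∈_)
open import Relation.Nullary using (¬_)
open import Relation.Binary.PropositionalEquality using (_≡_)

Subset : Set → Set₁
Subset E = E → Set

SetSystem : Set → Set₂
SetSystem E = Subset E → Set₁

module _ {E : Set} where

  _⊆_ : Subset E → Subset E → Set
  A ⊆ B = ∀ x → A x → B x

  _∪_ : Subset E → Subset E → Subset E
  (A ∪ B) x = A x ⊎ B x

  _+ₛ_ : Subset E → E → Subset E
  (A +ₛ e) x = A x ⊎ x ≡ e

  ∅ : Subset E
  ∅ _ = ⊥

  Finite : Subset E → Set
  Finite A = Σ[ xs ∈ List E ] (∀ x → A x → x ∈ xs)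

  Maximal : SetSystem E → Subset E → Set₁
  Maximal 𝓘 I = 𝓘 I × (∀ J → 𝓘 J → I ⊆ J → J ⊆ I)

  record IsMatroid (𝓘 : SetSystem E) : Set₂ where
    field
      I1 : 𝓘 ∅
      I2 : ∀ I J → 𝓘 J → I ⊆ J → 𝓘 I
      I3 : ∀ I I′ → 𝓘 I → Maximal 𝓘 I′ → ¬ Maximal 𝓘 I →
           Σ[ x ∈ E ] (I′ x × ¬ I x × 𝓘 (I +ₛ x))
      IM : ∀ I X → 𝓘 I → I ⊆ X →
           Σ[ J ∈ Subset E ] Maximal (λ I′ → 𝓘 I′ × I ⊆ I′ × I′ ⊆ X) J

record Matroid (E : Set) : Set₂ where
  field
    Ind       : SetSystem E
    isMatroid : IsMatroid Ind

module _ {E : Set} where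
  open Matroid

  IsBase : Matroid E → Subset E → Set₁
  IsBase M B = Maximal (Ind M) B

  -- Independent sets of the dual M*: the bases of M* are the complements
  -- of the bases of M, so the independent sets of M* are the sets
  -- contained in the complement of some base of M.
  DualInd : Matroid E → SetSystem E
  DualInd M I = Σ[ B ∈ Subset E ] (IsBase M B × (∀ x → I x → ¬ B x))

  FinitarySys : SetSystem E → Set₁
  FinitarySys 𝓘 = ∀ I → (∀ F → F ⊆ I → Finite F → 𝓘 F) → 𝓘 I

  Finitary : Matroid E → Set₁
  Finitary M = FinitarySys (Ind M)

  CoFinitary : Matroid E → Set₁
  CoFinitary M = FinitarySys (DualInd M)

  UnionInd : Matroid E → Matroid E → SetSystem E
  UnionInd M₁ M₂ I =
    Σ[ I₁ ∈ Subset E ] Σ[ I₂ ∈ Subset E ]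
      (Ind M₁ I₁ × Ind M₂ I₂ × I ⊆ (I₁ ∪ I₂) × (I₁ ∪ I₂) ⊆ I)

-- M₁ is a direct sum of rank-one uniform matroids on the finite fibres of γ
-- and M₂ a direct sum of circuits on the fibres of δ, so both duals are
-- finitary: a transversal of γ, resp. the complement of a transversal of δ,
-- is a base.  The δ-fibres are the pairs {bl k, br k} and the infinite columns
-- {dd j f : toℕ f = m}; the γ-fibre of level j is {bl j, br (j - 1)} together
-- with the dd j f.  Let Y = Y₁ ∪ Y₂ be independent in the union and contain
-- every bl and dd.  If Y contains all br n with n ≥ r, then Y₁ contains bl n
-- or br n for each such n, and a point of Y₁ on a level lo ≥ r pushes br lo,
-- br (lo + 1), … into Y₁, so Y₁ meets at most one level ≥ r; yet columns r
-- and r + 1 both need a point of Y₁.  Conversely, every such Y omitting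
-- infinitely many br's is independent.  Hence the set of all bl's and dd's has
-- no maximal independent superset, and (IM) fails.
module Submission where

open import Defs
open import Level using (0ℓ; Lift; lift; lower)
open import Axiom.ExcludedMiddle using (ExcludedMiddle)
open import Data.Product using (Σ; Σ-syntax; _×_; _,_; proj₁; proj₂)
open import Data.Sum using (_⊎_; inj₁; inj₂; [_,_])
open import Data.Empty using (⊥; ⊥-elim)
open import Data.Unit using (⊤; tt)
open import Data.Nat using (ℕ; zero; suc; pred; _+_; _∸_; _≤_; _<_; z≤n; s≤s)
open import Data.Nat.Properties
  using (≤-refl; ≤-trans; <-trans; ≤-<-trans; <⇒≤; <-irrefl; <-cmp; 1+n≢n;
         m≤m+n; m≤n+m; m∸n+n≡m; m≤n⇒m<n∨m≡n)
open import Data.Fin using (Fin; toℕ; fromℕ; fromℕ<)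
open import Data.Fin.Properties using (toℕ-injective; toℕ-fromℕ; toℕ-fromℕ<; toℕ≤pred[n])
open import Data.List using ([]; _∷_; map; allFin)
open import Data.List.Relation.Unary.Any using (here; there)
open import Data.List.Membership.Propositional.Properties using (∈-map⁺; ∈-allFin)
open import Function using (id; _∘_; case_of_)
open import Relation.Binary using (tri<; tri≈; tri>)
open import Relation.Binary.PropositionalEquality using (_≡_; _≢_; refl; sym; trans; cong; subst)
open import Relation.Nullary using (¬_; Dec; yes; no)
open import Relation.Nullary.Decidable using (map′; decidable-stable)

module Classical (em : ExcludedMiddle (Level.suc 0ℓ)) where

  decide : (P : Set) → Dec P
  decide P = map′ lower lift em

  dne : {P : Set} → ¬ ¬ P → P
  dne {P} = decidable-stable (decide P)

  ¬∀⇒∃¬ : {A : Set} {P Q : A → Set} → ¬ (∀ x → P x → Q x) → Σ A λ x → P x × ¬ Q x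
  ¬∀⇒∃¬ ¬∀ = dne λ ¬∃ → ¬∀ λ x Px → dne λ ¬Qx → ¬∃ (x , Px , ¬Qx)

Maximal-+ₛ : {E : Set} {𝓘 : SetSystem E} {B : Subset E} {x : E} →
             Maximal 𝓘 B → 𝓘 (B +ₛ x) → B x
Maximal-+ₛ (_ , max) B+x∈𝓘 = max _ B+x∈𝓘 (λ _ → inj₁) _ (inj₂ refl)

module RankOneSum (em : ExcludedMiddle (Level.suc 0ℓ)) {E K : Set} (γ : E → K)
                  (fibre-inhabited : ∀ j → Σ E λ x → γ x ≡ j) where
  open Classical em

  InjOn : Subset E → Set
  InjOn I = ∀ x y → I x → I y → γ x ≡ γ y → x ≡ y

  𝓘 : SetSystem E
  𝓘 I = Lift (Level.suc 0ℓ) (InjOn I)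

  Meets : Subset E → K → Set
  Meets I j = Σ E λ y → I y × γ y ≡ j

  InjOn-+ₛ : ∀ {I y} → InjOn I → ¬ Meets I (γ y) → InjOn (I +ₛ y)
  InjOn-+ₛ inj ¬m x z (inj₁ Ix) (inj₁ Iz) e = inj x z Ix Iz e
  InjOn-+ₛ inj ¬m x _ (inj₁ Ix) (inj₂ refl) e = ⊥-elim (¬m (x , Ix , e))
  InjOn-+ₛ inj ¬m _ z (inj₂ refl) (inj₁ Iz) e = ⊥-elim (¬m (z , Iz , sym e))
  InjOn-+ₛ inj ¬m _ _ (inj₂ refl) (inj₂ refl) e = refl

  meets-all⇒maximal : ∀ {X J} → (∀ x → X x → Meets J (γ x)) →
                      ∀ J′ → InjOn J′ → J ⊆ J′ → J′ ⊆ X → J′ ⊆ J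
  meets-all⇒maximal {J = J} meets J′ inj J⊆J′ J′⊆X x J′x with meets x (J′⊆X x J′x)
  ... | y , Jy , e = subst J (inj y x (J⊆J′ y Jy) J′x e) Jy

  maximal-if-meets-all : ∀ {B} → InjOn B → (∀ x → Meets B (γ x)) → Maximal 𝓘 B
  maximal-if-meets-all inj meets = lift inj , λ J (lift injJ) B⊆J →
    meets-all⇒maximal {X = λ _ → ⊤} (λ x _ → meets x) J injJ B⊆J (λ _ _ → tt)

  maximal⇒meets-all : ∀ {B} → Maximal 𝓘 B → ∀ x → Meets B (γ x)
  maximal⇒meets-all maxB@(lift inj , _) x =
    dne λ ¬m → ¬m (x , Maximal-+ₛ maxB (lift (InjOn-+ₛ inj ¬m)) , refl)

  ¬maximal⇒unmet : ∀ {I} → InjOn I → ¬ Maximal 𝓘 I → Σ E λ x → ¬ Meets I (γ x)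
  ¬maximal⇒unmet inj ¬maxI =
    dne λ ¬∃ → ¬maxI (maximal-if-meets-all inj λ x → dne λ ¬m → ¬∃ (x , ¬m))

  exchange : ∀ I I′ → 𝓘 I → Maximal 𝓘 I′ → ¬ Maximal 𝓘 I →
             Σ[ x ∈ E ] (I′ x × ¬ I x × 𝓘 (I +ₛ x))
  exchange I I′ (lift inj) maxI′ ¬maxI with ¬maximal⇒unmet inj ¬maxI
  ... | x , ¬m with maximal⇒meets-all maxI′ x
  ... | y , I′y , e =
    y , I′y , (λ Iy → ¬m (y , Iy , e)) , lift (InjOn-+ₛ inj (¬m ∘ subst (Meets I) e))

  augment : ∀ I X → 𝓘 I → I ⊆ X →
            Σ[ J ∈ Subset E ] Maximal (λ I′ → 𝓘 I′ × I ⊆ I′ × I′ ⊆ X) J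
  augment I X (lift injI) I⊆X = J , (lift injJ , (λ _ → inj₁) , J⊆X) ,
    λ J′ (lift injJ′ , _ , J′⊆X) J⊆J′ → meets-all⇒maximal meets J′ injJ′ J⊆J′ J′⊆X
    where
    pick : ∀ j → Σ E λ c → Meets X j → X c × γ c ≡ j
    pick j with decide (Meets X j)
    ... | yes (c , Xc , e) = c , λ _ → Xc , e
    ... | no ¬m = proj₁ (fibre-inhabited j) , ⊥-elim ∘ ¬m

    c : K → E
    c j = proj₁ (pick j)

    J : Subset E
    J x = I x ⊎ (¬ Meets I (γ x) × x ≡ c (γ x) × X x)

    J⊆X : J ⊆ X
    J⊆X x (inj₁ Ix) = I⊆X x Ix
    J⊆X x (inj₂ (_ , _ , Xx)) = Xx

    injJ : InjOn J
    injJ x y (inj₁ Ix) (inj₁ Iy) e = injI x y Ix Iy e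
    injJ x y (inj₁ Ix) (inj₂ (¬m , _)) e = ⊥-elim (¬m (x , Ix , e))
    injJ x y (inj₂ (¬m , _)) (inj₁ Iy) e = ⊥-elim (¬m (y , Iy , sym e))
    injJ x y (inj₂ (_ , x≡c , _)) (inj₂ (_ , y≡c , _)) e = trans x≡c (trans (cong c e) (sym y≡c))

    meets : ∀ x → X x → Meets J (γ x)
    meets x Xx with decide (Meets I (γ x)) | proj₂ (pick (γ x)) (x , Xx , refl)
    ... | yes (y , Iy , e) | _ = y , inj₁ Iy , e
    ... | no ¬m | Xc , e =
      c (γ x) , inj₂ (¬m ∘ subst (Meets I) e , cong c (sym e) , Xc) , e

  matroid : Matroid E
  matroid = record
    { Ind = 𝓘
    ; isMatroid = record
      { I1 = lift λ _ _ ()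
      ; I2 = λ I J (lift inj) I⊆J → lift λ x y Ix Iy → inj x y (I⊆J x Ix) (I⊆J y Iy)
      ; I3 = exchange
      ; IM = augment
      }
    }

  cofinitary : (∀ j → Finite (λ x → γ x ≡ j)) → CoFinitary matroid
  cofinitary fibre-finite I finite⇒coindependent =
    B , maximal-if-meets-all injB meetsB , λ x Ix x≡w → proj₂ (proj₂ (pick (γ x))) (subst I x≡w Ix)
    where
    fibre⊈I : ∀ j → ¬ (∀ x → γ x ≡ j → I x)
    fibre⊈I j fibre⊆I with finite⇒coindependent (λ x → γ x ≡ j) fibre⊆I (fibre-finite j)
    ... | B′ , maxB′ , disjoint with maximal⇒meets-all maxB′ (proj₁ (fibre-inhabited j))
    ... | y , B′y , e = disjoint y (trans e (proj₂ (fibre-inhabited j))) B′y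

    pick : ∀ j → Σ E λ x → γ x ≡ j × ¬ I x
    pick j = ¬∀⇒∃¬ (fibre⊈I j)

    w : K → E
    w j = proj₁ (pick j)

    B : Subset E
    B x = x ≡ w (γ x)

    injB : InjOn B
    injB x y x≡w y≡w e = trans x≡w (trans (cong w e) (sym y≡w))

    meetsB : ∀ x → Meets B (γ x)
    meetsB x = w (γ x) , cong w (sym w-fibre) , w-fibre
      where
      w-fibre : γ (w (γ x)) ≡ γ x
      w-fibre = proj₁ (proj₂ (pick (γ x)))

module CircuitSum (em : ExcludedMiddle (Level.suc 0ℓ)) {E K : Set} (δ : E → K)
                  (fibre-inhabited : ∀ d → Σ E λ x → δ x ≡ d) where
  open Classical em

  Full : Subset E → K → Set
  Full I d = ∀ x → δ x ≡ d → I x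

  NoFullFibre : Subset E → Set
  NoFullFibre I = ∀ d → ¬ Full I d

  𝓘 : SetSystem E
  𝓘 I = Lift (Level.suc 0ℓ) (NoFullFibre I)

  NoFullFibre-+ₛ : ∀ {I x z} → NoFullFibre I → δ z ≡ δ x → ¬ I z → z ≢ x → NoFullFibre (I +ₛ x)
  NoFullFibre-+ₛ {x = x} {z} nf e ¬Iz z≢x d full with decide (d ≡ δ x)
  ... | yes refl = [ ¬Iz , z≢x ] (full z e)
  ... | no d≢δx = nf d λ y e′ → [ id , (λ { refl → ⊥-elim (d≢δx (sym e′)) }) ] (full y e′)

  missing : ∀ {I} → NoFullFibre I → ∀ d → Σ E λ c → δ c ≡ d × ¬ I c
  missing nf d = ¬∀⇒∃¬ (nf d)

  Saturated : Subset E → Subset E → Set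
  Saturated X J = ∀ x → X x → ¬ J x → Full (J +ₛ x) (δ x)

  MissesAtMostOne : Subset E → Set
  MissesAtMostOne J = ∀ x y → δ x ≡ δ y → ¬ J x → ¬ J y → x ≡ y

  saturated⇒maximal : ∀ {X J} → Saturated X J →
                      ∀ J′ → NoFullFibre J′ → J ⊆ J′ → J′ ⊆ X → J′ ⊆ J
  saturated⇒maximal sat J′ nf J⊆J′ J′⊆X x J′x = dne λ ¬Jx →
    nf (δ x) λ y e → [ J⊆J′ y , (λ { refl → J′x }) ] (sat x (J′⊆X x J′x) ¬Jx y e)

  maximal-if-misses-≤1 : ∀ {B} → NoFullFibre B → MissesAtMostOne B → Maximal 𝓘 B
  maximal-if-misses-≤1 {B} nf misses = lift nf , λ J (lift nfJ) B⊆J →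
    saturated⇒maximal {X = λ _ → ⊤} sat J nfJ B⊆J (λ _ _ → tt)
    where
    sat : Saturated (λ _ → ⊤) B
    sat x _ ¬Bx y e with decide (B y)
    ... | yes By = inj₁ By
    ... | no ¬By = inj₂ (misses y x e ¬By ¬Bx)

  maximal⇒misses-≤1 : ∀ {B} → Maximal 𝓘 B → MissesAtMostOne B
  maximal⇒misses-≤1 maxB@(lift nf , _) x y e ¬Bx ¬By =
    dne λ x≢y → ¬Bx (Maximal-+ₛ maxB (lift (NoFullFibre-+ₛ nf (sym e) ¬By (x≢y ∘ sym))))

  ¬maximal⇒two-missing : ∀ {I} → NoFullFibre I → ¬ Maximal 𝓘 I →
                         Σ E λ x → Σ E λ z → δ x ≡ δ z × ¬ I x × ¬ I z × x ≢ z
  ¬maximal⇒two-missing nf ¬maxI = dne λ ¬two → ¬maxI (maximal-if-misses-≤1 nf λ x z e ¬Ix ¬Iz →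
    dne λ x≢z → ¬two (x , z , e , ¬Ix , ¬Iz , x≢z))

  exchange : ∀ I I′ → 𝓘 I → Maximal 𝓘 I′ → ¬ Maximal 𝓘 I →
             Σ[ x ∈ E ] (I′ x × ¬ I x × 𝓘 (I +ₛ x))
  exchange I I′ (lift nf) maxI′ ¬maxI with ¬maximal⇒two-missing nf ¬maxI
  ... | x , z , e , ¬Ix , ¬Iz , x≢z with decide (I′ x) | decide (I′ z)
  ... | yes I′x | _ = x , I′x , ¬Ix , lift (NoFullFibre-+ₛ nf (sym e) ¬Iz (x≢z ∘ sym))
  ... | no _ | yes I′z = z , I′z , ¬Iz , lift (NoFullFibre-+ₛ nf e ¬Ix x≢z)
  ... | no ¬I′x | no ¬I′z = ⊥-elim (x≢z (maximal⇒misses-≤1 maxI′ x z e ¬I′x ¬I′z))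

  augment : ∀ I X → 𝓘 I → I ⊆ X →
            Σ[ J ∈ Subset E ] Maximal (λ I′ → 𝓘 I′ × I ⊆ I′ × I′ ⊆ X) J
  augment I X (lift nfI) I⊆X = J , (lift nfJ , I⊆J , (λ _ → proj₁)) ,
    λ J′ (lift nfJ′ , _ , J′⊆X) J⊆J′ → saturated⇒maximal sat J′ nfJ′ J⊆J′ J′⊆X
    where
    c : K → E
    c d = proj₁ (missing nfI d)

    c-fibre : ∀ d → δ (c d) ≡ d
    c-fibre d = proj₁ (proj₂ (missing nfI d))

    J : Subset E
    J x = X x × ¬ (Full X (δ x) × x ≡ c (δ x))

    I⊆J : I ⊆ J
    I⊆J x Ix = I⊆X x Ix , λ (_ , x≡c) → proj₂ (proj₂ (missing nfI (δ x))) (subst I x≡c Ix)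

    nfJ : NoFullFibre J
    nfJ d full = proj₂ (full (c d) (c-fibre d))
      ((λ y e → proj₁ (full y (trans e (c-fibre d)))) , cong c (sym (c-fibre d)))

    sat : Saturated X J
    sat x Xx ¬Jx y e with dne (λ ¬cut → ¬Jx (Xx , ¬cut)) | decide (y ≡ x)
    ... | _ | yes y≡x = inj₂ y≡x
    ... | fullX , x≡c | no y≢x =
      inj₁ (fullX y e , λ (_ , y≡c) → y≢x (trans y≡c (trans (cong c e) (sym x≡c))))

  matroid : Matroid E
  matroid = record
    { Ind = 𝓘
    ; isMatroid = record
      { I1 = lift λ d full → full (proj₁ (fibre-inhabited d)) (proj₂ (fibre-inhabited d))
      ; I2 = λ I J (lift nf) I⊆J → lift λ d full → nf d λ x e → I⊆J x (full x e)
      ; I3 = exchange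
      ; IM = augment
      }
    }

  cotransversal-maximal : (w : K → E) → (∀ d → δ (w d) ≡ d) → Maximal 𝓘 (λ x → x ≢ w (δ x))
  cotransversal-maximal w w-fibre = maximal-if-misses-≤1 nf misses
    where
    nf : NoFullFibre (λ x → x ≢ w (δ x))
    nf d full = full (w d) (w-fibre d) (cong w (sym (w-fibre d)))

    misses : MissesAtMostOne (λ x → x ≢ w (δ x))
    misses x y e x∉ y∉ = trans (dne x∉) (trans (cong w e) (sym (dne y∉)))

  cofinitary : CoFinitary matroid
  cofinitary I finite⇒coindependent =
    (λ x → x ≢ w (δ x)) , cotransversal-maximal w (λ d → proj₁ (proj₂ (pick d))) ,
    λ x Ix x≢w → x≢w (proj₂ (proj₂ (pick (δ x))) x refl Ix)
    where
    at-most-one : ∀ {x y} → I x → I y → δ x ≡ δ y → x ≡ y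
    at-most-one {x} {y} Ix Iy e
      with finite⇒coindependent (λ z → z ≡ x ⊎ z ≡ y)
             (λ { _ (inj₁ refl) → Ix ; _ (inj₂ refl) → Iy })
             (x ∷ y ∷ [] , λ { _ (inj₁ refl) → here refl ; _ (inj₂ refl) → there (here refl) })
    ... | _ , maxB , disjoint =
      maximal⇒misses-≤1 maxB x y e (disjoint x (inj₁ refl)) (disjoint y (inj₂ refl))

    pick : ∀ d → Σ E λ c → δ c ≡ d × (∀ x → δ x ≡ d → I x → x ≡ c)
    pick d with decide (Σ E λ x → δ x ≡ d × I x)
    ... | yes (c , e , Ic) = c , e , λ x e′ Ix → at-most-one Ix Ic (trans e′ (sym e))
    ... | no ¬∃ = proj₁ (fibre-inhabited d) , proj₂ (fibre-inhabited d) ,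
                  λ x e Ix → ⊥-elim (¬∃ (x , e , Ix))

    w : K → E
    w d = proj₁ (pick d)

Unbounded : (ℕ → Set) → Set
Unbounded P = ∀ r → Σ ℕ λ n → r ≤ n × P n

Unbounded-∖ : ∀ {P} k → Unbounded P → Unbounded (λ n → P n × n ≢ k)
Unbounded-∖ k unb r with unb (suc (r + k))
... | n , r+k<n , Pn =
  n , ≤-trans (m≤m+n r k) (<⇒≤ r+k<n) , Pn ,
  λ n≡k → <-irrefl (sym n≡k) (≤-<-trans (m≤n+m k r) r+k<n)

module Enumeration {P : ℕ → Set} (unb : Unbounded P) where

  enum : ℕ → ℕ
  enum zero = proj₁ (unb zero)
  enum (suc m) = proj₁ (unb (suc (enum m)))

  enum-∈ : ∀ m → P (enum m)
  enum-∈ zero = proj₂ (proj₂ (unb zero))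
  enum-∈ (suc m) = proj₂ (proj₂ (unb (suc (enum m))))

  enum-step : ∀ m → enum m < enum (suc m)
  enum-step m = proj₁ (proj₂ (unb (suc (enum m))))

module StepIncreasing (f : ℕ → ℕ) (step : ∀ m → f m < f (suc m)) where

  mono-< : ∀ {a b} → a < b → f a < f b
  mono-< {a} {suc b} (s≤s a≤b) with m≤n⇒m<n∨m≡n a≤b
  ... | inj₁ a<b = <-trans (mono-< a<b) (step b)
  ... | inj₂ refl = step a

  injective : ∀ {a b} → f a ≡ f b → a ≡ b
  injective {a} {b} fa≡fb with <-cmp a b
  ... | tri< a<b _ _ = ⊥-elim (<-irrefl fa≡fb (mono-< a<b))
  ... | tri≈ _ a≡b _ = a≡b
  ... | tri> _ _ b<a = ⊥-elim (<-irrefl (sym fa≡fb) (mono-< b<a))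

  inflationary : ∀ m → m ≤ f m
  inflationary zero = z≤n
  inflationary (suc m) = ≤-trans (s≤s (inflationary m)) (step m)

module Counterexample (em : ExcludedMiddle (Level.suc 0ℓ)) where
  open Classical em

  data Column : Set where
    B D : ℕ → Column

  data E : Set where
    bl br : ℕ → E
    dd : (j : ℕ) → Fin (suc j) → E

  γ : E → ℕ
  γ (bl k) = k
  γ (br k) = suc k
  γ (dd j f) = j

  δ : E → Column
  δ (bl k) = B k
  δ (br k) = B k
  δ (dd j f) = D (toℕ f)

  D-injective : ∀ {m n} → D m ≡ D n → m ≡ n
  D-injective refl = refl

  γ-fibre-inhabited : ∀ j → Σ E λ x → γ x ≡ j
  γ-fibre-inhabited j = bl j , refl

  δ-fibre-inhabited : ∀ d → Σ E λ x → δ x ≡ d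
  δ-fibre-inhabited (B k) = bl k , refl
  δ-fibre-inhabited (D m) = dd m (fromℕ m) , cong D (toℕ-fromℕ m)

  -- For j = 0 the listed rung br 0 lies in the fibre of 1, which is harmless.
  γ-fibre-finite : ∀ j → Finite (λ x → γ x ≡ j)
  γ-fibre-finite j = bl j ∷ br (pred j) ∷ map (dd j) (allFin (suc j)) , λ where
    (bl _) refl → here refl
    (br _) refl → there (here refl)
    (dd _ f) refl → there (there (∈-map⁺ (dd j) (∈-allFin f)))

  open RankOneSum em γ γ-fibre-inhabited
    using (InjOn) renaming (matroid to M₁; cofinitary to M₁-cofinitary) public
  open CircuitSum em δ δ-fibre-inhabited
    using (NoFullFibre) renaming (matroid to M₂; cofinitary to M₂-cofinitary) public

  Spine : (ℕ → Set) → Subset E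
  Spine S (bl _) = ⊤
  Spine S (br j) = S j
  Spine S (dd _ _) = ⊤

  Skeleton : Subset E
  Skeleton = Spine (λ _ → ⊥)

  Skeleton⊆Spine : ∀ S → Skeleton ⊆ Spine S
  Skeleton⊆Spine S (bl _) _ = tt
  Skeleton⊆Spine S (dd _ _) _ = tt

  Spine-independent : ∀ {S} → Unbounded (λ n → ¬ S n) → UnionInd M₁ M₂ (Spine S)
  Spine-independent {S} unb =
    J₁ , J₂ , lift injJ₁ , lift nfJ₂ , cover , (λ x → [ J₁⊆Spine x , proj₁ ])
    where
    open Enumeration unb
    open StepIncreasing enum enum-step

    -- column m is served on level enum m, whose bl is free because br (enum m) is absent
    J₁ : Subset E
    J₁ (bl j) = S j
    J₁ (br _) = ⊥
    J₁ (dd j f) = j ≡ enum (toℕ f)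

    J₂ : Subset E
    J₂ x = Spine S x × ¬ J₁ x

    J₁⊆Spine : J₁ ⊆ Spine S
    J₁⊆Spine (bl _) _ = tt
    J₁⊆Spine (dd _ _) _ = tt

    cover : Spine S ⊆ (J₁ ∪ J₂)
    cover x Sx with decide (J₁ x)
    ... | yes J₁x = inj₁ J₁x
    ... | no ¬J₁x = inj₂ (Sx , ¬J₁x)

    injJ₁ : InjOn J₁
    injJ₁ (bl _) (bl _) _ _ e = cong bl e
    injJ₁ (bl _) (dd _ f) Sa j≡e a≡j = ⊥-elim (enum-∈ (toℕ f) (subst S (trans a≡j j≡e) Sa))
    injJ₁ (dd _ f) (bl _) j≡e Sa j≡a = ⊥-elim (enum-∈ (toℕ f) (subst S (trans (sym j≡a) j≡e) Sa))
    injJ₁ (dd j f) (dd _ g) j≡ef j≡eg refl =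
      cong (dd j) (toℕ-injective (injective (trans (sym j≡ef) j≡eg)))

    nfJ₂ : NoFullFibre J₂
    nfJ₂ (B j) full = proj₂ (full (bl j) refl) (proj₁ (full (br j) refl))
    nfJ₂ (D m) full =
      proj₂ (full (dd (enum m) (fromℕ< m<)) (cong D (toℕ-fromℕ< m<))) (cong enum (sym (toℕ-fromℕ< m<)))
      where
      m< : m < suc (enum m)
      m< = s≤s (inflationary m)

  Skeleton-independent : UnionInd M₁ M₂ Skeleton
  Skeleton-independent = Spine-independent λ r → r , ≤-refl , λ ()

  module _ {Y J₁ J₂ : Subset E} (inj : InjOn J₁) (nf : NoFullFibre J₂)
           (Y⊆J₁∪J₂ : Y ⊆ (J₁ ∪ J₂)) (Skeleton⊆Y : Skeleton ⊆ Y) where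

    rung-in-J₁ : ∀ {k} → Y (br k) → J₁ (bl k) ⊎ J₁ (br k)
    rung-in-J₁ {k} Ybr with Y⊆J₁∪J₂ (bl k) (Skeleton⊆Y (bl k) tt) | Y⊆J₁∪J₂ (br k) Ybr
    ... | inj₁ J₁bl | _ = inj₁ J₁bl
    ... | inj₂ _ | inj₁ J₁br = inj₂ J₁br
    ... | inj₂ J₂bl | inj₂ J₂br = ⊥-elim (nf (B k) λ where
      (bl _) refl → J₂bl
      (br _) refl → J₂br
      (dd _ _) ())

    column-meets-J₁ : ∀ m → Σ ℕ λ j → Σ (Fin (suc j)) λ f → toℕ f ≡ m × J₁ (dd j f)
    column-meets-J₁ m = dne λ ¬∃ → nf (D m) λ where
      (dd j f) e → [ (λ J₁dd → ⊥-elim (¬∃ (j , f , D-injective e , J₁dd))) , id ]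
                     (Y⊆J₁∪J₂ (dd j f) (Skeleton⊆Y (dd j f) tt))
      (bl _) ()
      (br _) ()

    rungs-in-J₁ : ∀ {lo} {f : Fin (suc lo)} → J₁ (dd lo f) → (∀ n → lo ≤ n → Y (br n)) →
                  ∀ t → J₁ (br (t + lo))
    rungs-in-J₁ {lo} {f} J₁dd Yrungs zero with rung-in-J₁ (Yrungs lo ≤-refl)
    ... | inj₁ J₁bl = case inj (bl lo) (dd lo f) J₁bl J₁dd refl of λ ()
    ... | inj₂ J₁br = J₁br
    rungs-in-J₁ {lo} J₁dd Yrungs (suc t) with rung-in-J₁ (Yrungs (suc t + lo) (m≤n+m lo (suc t)))
    ... | inj₁ J₁bl = case inj (bl _) (br (t + lo)) J₁bl (rungs-in-J₁ J₁dd Yrungs t) refl of λ ()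
    ... | inj₂ J₁br = J₁br

    two-levels⇒¬all-rungs : ∀ {lo hi} {f : Fin (suc lo)} {g : Fin (suc hi)} → lo < hi →
                            J₁ (dd lo f) → J₁ (dd hi g) → ¬ (∀ n → lo ≤ n → Y (br n))
    two-levels⇒¬all-rungs {lo} {suc h} {g = g} (s≤s lo≤h) J₁f J₁g Yrungs =
      case inj (br h) (dd (suc h) g) J₁br J₁g refl of λ ()
      where
      J₁br : J₁ (br h)
      J₁br = subst (J₁ ∘ br) (m∸n+n≡m lo≤h) (rungs-in-J₁ J₁f Yrungs (h ∸ lo))

    rungs-missing : Unbounded (λ n → ¬ Y (br n))
    rungs-missing r = ¬∀⇒∃¬ not-all-rungs
      where
      not-all-rungs : ¬ (∀ n → r ≤ n → Y (br n))
      not-all-rungs Yrungs with column-meets-J₁ r | column-meets-J₁ (suc r)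
      ... | s₁ , f₁ , e₁ , J₁f₁ | s₂ , f₂ , e₂ , J₁f₂ with <-cmp s₁ s₂
      ... | tri< s₁<s₂ _ _ = two-levels⇒¬all-rungs s₁<s₂ J₁f₁ J₁f₂ λ n s₁≤n →
              Yrungs n (≤-trans (subst (_≤ s₁) e₁ (toℕ≤pred[n] f₁)) s₁≤n)
      ... | tri≈ _ refl _ = 1+n≢n (trans (sym e₂) (trans (sym same-index) e₁))
        where
        same-index : toℕ f₁ ≡ toℕ f₂
        same-index = D-injective (cong δ (inj _ _ J₁f₁ J₁f₂ refl))
      ... | tri> _ _ s₂<s₁ = two-levels⇒¬all-rungs s₂<s₁ J₁f₂ J₁f₁ λ n s₂≤n →
              Yrungs n (≤-trans (<⇒≤ (subst (_≤ s₂) e₂ (toℕ≤pred[n] f₂))) s₂≤n)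

  union-independent⇒rungs-missing : ∀ {Y} → UnionInd M₁ M₂ Y → Skeleton ⊆ Y →
                                    Unbounded (λ n → ¬ Y (br n))
  union-independent⇒rungs-missing (_ , _ , lift inj , lift nf , Y⊆ , _) =
    rungs-missing inj nf Y⊆

  union-not-matroid : ¬ IsMatroid (UnionInd M₁ M₂)
  union-not-matroid isM
    with IsMatroid.IM isM Skeleton (λ _ → ⊤) Skeleton-independent (λ _ _ → tt)
  ... | J , (J-ind , Skeleton⊆J , _) , maxJ =
    ¬Jk (maxJ (Spine S) (S-ind , Skeleton⊆Spine S , λ _ _ → tt) J⊆Spine (br k) (inj₂ refl))
    where
    gaps : Unbounded (λ n → ¬ J (br n))
    gaps = union-independent⇒rungs-missing J-ind Skeleton⊆J

    k : ℕ
    k = proj₁ (gaps 0)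

    ¬Jk : ¬ J (br k)
    ¬Jk = proj₂ (proj₂ (gaps 0))

    S : ℕ → Set
    S n = J (br n) ⊎ n ≡ k

    S-ind : UnionInd M₁ M₂ (Spine S)
    S-ind = Spine-independent λ r →
      let (n , r≤n , ¬Jn , n≢k) = Unbounded-∖ k gaps r in n , r≤n , [ ¬Jn , n≢k ]

    J⊆Spine : J ⊆ Spine S
    J⊆Spine (bl _) _ = tt
    J⊆Spine (br _) Jbr = inj₁ Jbr
    J⊆Spine (dd _ _) _ = tt

corollary3p3 : ExcludedMiddle (Level.suc 0ℓ) →
    Σ[ E ∈ Set ] Σ[ M₁ ∈ Matroid E ] Σ[ M₂ ∈ Matroid E ]
    (CoFinitary M₁ × CoFinitary M₂ × ¬ IsMatroid (UnionInd M₁ M₂))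
corollary3p3 em =
  E , M₁ , M₂ , M₁-cofinitary γ-fibre-finite , M₂-cofinitary , union-not-matroid
  where open Counterexample em
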